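{- For integers $i \ge 0$ and $j$, let $f(i,j)$ denote the number of permutations of $\{0,1,\dots,i-1\}$ having exactly $j$ type 4 adjacencies (with $f(i,j)=0$ whenever $j<0$ or $j>i+1$). Then for every $i\ge 3$ and every $0\le j\le i+1$, $$\begin{aligned} f(i,j) ={}& (i-j-2)\big(f(i-1,j)-f(i-2,j-1)\big) \\ &+ 2\big(f(i-1,j-1)-f(i-2,j-2)\big) + f(i-2,j-2) \\ &+ (j+1)\big(f(i-1,j+1)-f(i-2,j)\big) + (i-j-1)\, f(i-2,j) + (j+1)\, f(i-2,j+1).\end{aligned}$$
   Context: A permutation of $\{0,1,\dots,n-1\}$ is written as a sequence $\pi=(\pi_1,\dots,\pi_n)$ in which each symbol occurs exactly once. The type 4 adjacencies (front-and-back adjacencies) of $\pi$ are: each index $i\in\{1,\dots,n-1\}$ with $\pi_{i+1}=\pi_i+1$; one more adjacency if $\pi_n=n-1$ (adjacent to an imagined $\pi_{n+1}=n$); and one more adjacency if $\pi_1=0$ (adjacent to an imagined $\pi_0=-1$). Thus a permutation of $\{0,\dots,n-1\}$ has between $0$ and $n+1$ type 4 adjacencies. -}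

module Defs where

open import Data.Nat using (ℕ; zero; suc; _+_; _∸_; _≟_)
open import Data.Fin using (Fin; toℕ)
open import Data.List using (List; []; _∷_; map; concatMap; length; filter; allFin)
open import Data.List.Relation.Unary.All using (All)
open import Data.List.Relation.Unary.All.Properties using ()
open import Data.List.Relation.Unary.All using (all?)
open import Data.Integer using (ℤ; +_; -[1+_])
open import Relation.Nullary.Decidable using (does)
open import Data.Bool using (if_then_else_)
import Data.List.Relation.Unary.All as All
open import Relation.Nullary using (Dec)
open import Data.Nat.Properties using ()
open import Relation.Binary.PropositionalEquality using (_≡_)

words : (n k : ℕ) → List (List ℕ)
words n zero    = [] ∷ []
words n (suc k) = concatMap (λ a → map (toℕ a ∷_) (words n k)) (allFin n)

occ : ℕ → List ℕ → ℕ
occ a []       = 0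
occ a (x ∷ xs) = if does (x ≟ a) then suc (occ a xs) else occ a xs

IsPerm : ℕ → List ℕ → Set
IsPerm n w = All (λ a → occ (toℕ a) w ≡ 1) (allFin n)

isPerm? : ∀ n w → Dec (IsPerm n w)
isPerm? n w = all? (λ a → occ (toℕ a) w ≟ 1) (allFin n)

perms : ℕ → List (List ℕ)
perms n = filter (isPerm? n) (words n n)

inner : List ℕ → ℕ
inner []            = 0
inner (x ∷ [])      = 0
inner (x ∷ y ∷ xs)  = (if does (y ≟ suc x) then 1 else 0) + inner (y ∷ xs)

front : List ℕ → ℕ
front []      = 0
front (x ∷ _) = if does (x ≟ 0) then 1 else 0

lastEl : ℕ → List ℕ → ℕ
lastEl d []       = d
lastEl d (x ∷ xs) = lastEl x xs

back : ℕ → List ℕ → ℕ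
back n []       = 0
back n (x ∷ xs) = if does (lastEl x xs ≟ (n ∸ 1)) then 1 else 0

adj4 : ℕ → List ℕ → ℕ
adj4 n π = inner π + back n π + front π

-- f(i,j): number of permutations of {0,…,i-1} with exactly j type 4 adjacencies
-- (0 for j < 0; automatically 0 for j > i+1)
countAdj : ℕ → ℕ → ℕ
countAdj i j = length (filter (λ π → adj4 i π ≟ j) (perms i))

f : ℕ → ℤ → ℤ
f i (+ j)    = + countAdj i j
f i -[1+ _ ] = + 0

module Submission where

-- The recurrence is proved by inserting the largest symbol.  Every
-- permutation of {0,…,n} arises exactly once by inserting n into one of the
-- n+1 gaps of a permutation π of {0,…,n-1} (`perms-insert`).  Reading π
-- between the imagined boundaries -1 and n, an interior gap either lies
-- inside an adjacency (the insertion breaks it), or follows n-1 (the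
-- insertion joins n-1 and n), or neither; the final gap always adds one
-- adjacency.  Counting gap kinds (`insertion-counts`) shows that the number
-- of insertions landing on j adjacencies depends only on the adjacency
-- number k of π and on whether π ends in n-1: it is an integer combination
-- of six indicators of (ends, k) (`insertions-by-class`).  Summing over π
-- writes f(n+1, j) through the sizes of these six classes
-- (`decomposition`).  Permutations ending in n-1 are the permutations of
-- {0,…,n-2} with the symbol n-1 appended, which adds one adjacency
-- (`ending-count`); the others are the remainder.  Substituting these class
-- sizes and regrouping gives the stated recurrence.

module Insertion where
  open import Defs
  open import Data.Nat using (ℕ; zero; suc; pred; _+_; _*_; _≤_; _<_; z≤n; s≤s; _≟_; _≡ᵇ_)
  open import Data.Nat.Properties
  open import Data.Nat.Tactic.RingSolver using (solve-∀)
  open import Algebra.Properties.CommutativeSemigroup +-commutativeSemigroup using (x∙yz≈y∙xz)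
  open import Data.Bool using (Bool; true; false; if_then_else_; not; _∧_)
  open import Data.Fin using (toℕ; fromℕ<)
  open import Data.Fin.Properties using (toℕ-fromℕ<; toℕ-injective; toℕ<n)
  open import Data.List using (List; []; _∷_; map; concatMap; length; filter; allFin; _++_)
  open import Data.Nat.ListAction using (sum)
  open import Data.List.Properties using (map-++; map-∘; map-cong-local)
  open import Function.Base using (_∘_)
  open import Data.List.Relation.Unary.All as All using (All; []; _∷_)
  open import Data.List.Relation.Unary.AllPairs using ([]; _∷_)
  open import Data.List.Relation.Unary.Any using (here; there)
  open import Data.List.Relation.Unary.Unique.Propositional using (Unique)
  import Data.List.Relation.Unary.Unique.Propositional.Properties as Unique
  open import Data.List.Membership.Propositional using (_∈_; find; lose)
  open import Data.List.Membership.Propositional.Properties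
    using (∈-map⁺; ∈-map⁻; ∈-filter⁺; ∈-filter⁻; ∈-allFin; ∈-concatMap⁺; ∈-concatMap⁻)
  open import Data.List.Membership.Propositional.Properties.WithK using (unique∧set⇒bag)
  open import Data.List.Relation.Binary.BagAndSetEquality using (∼bag⇒↭)
  open import Data.List.Relation.Binary.Permutation.Propositional as ↭ using (_↭_)
  open import Data.Product using (Σ; _×_; _,_; proj₁; proj₂)
  open import Data.Empty using (⊥-elim)
  open import Function.Bundles using (mk⇔)
  open import Relation.Nullary using (¬_; Dec; yes; no)
  open import Relation.Nullary.Reflects using (Reflects; ofʸ; ofⁿ)
  open import Relation.Nullary.Decidable using (does; proof; dec-true; dec-false)
  open import Relation.Binary.PropositionalEquality
    using (_≡_; _≢_; ≢-sym; refl; sym; trans; cong; cong₂; subst; module ≡-Reasoning)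

  -- Boolean equality of naturals.  Every test `does (x ≟ a)` in Defs
  -- computes to `x ≡ᵇ a`, which reflects `x ≡ a`.

  ≡ᵇ-reflects : ∀ x a → Reflects (x ≡ a) (x ≡ᵇ a)
  ≡ᵇ-reflects x a = proof (x ≟ a)

  ≡ᵇ-refl : ∀ v → (v ≡ᵇ v) ≡ true
  ≡ᵇ-refl v = dec-true (v ≟ v) refl

  ≡ᵇ-≢ : ∀ {x a} → x ≢ a → (x ≡ᵇ a) ≡ false
  ≡ᵇ-≢ {x} {a} = dec-false (x ≟ a)

  ≡ᵇ-sym : ∀ x a → (x ≡ᵇ a) ≡ (a ≡ᵇ x)
  ≡ᵇ-sym x a with x ≡ᵇ a | ≡ᵇ-reflects x a
  ... | .true  | ofʸ refl = sym (≡ᵇ-refl x)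
  ... | .false | ofⁿ x≢a  = sym (≡ᵇ-≢ (λ a≡x → x≢a (sym a≡x)))

  -- Counting list elements that satisfy a Boolean predicate.  The
  -- indicator `ι` is written exactly as the tests in Defs, so
  -- `if b then 1 else 0` is `ι b` by definition.

  ι : Bool → ℕ
  ι b = if b then 1 else 0

  cnt : {A : Set} → (A → Bool) → List A → ℕ
  cnt p []       = 0
  cnt p (x ∷ xs) = ι (p x) + cnt p xs

  module _ {A : Set} where

    length-filter : ∀ {P : A → Set} (P? : ∀ x → Dec (P x)) xs →
                    length (filter P? xs) ≡ cnt (λ x → does (P? x)) xs
    length-filter P? [] = refl
    length-filter P? (x ∷ xs) with does (P? x)
    ... | true  = cong suc (length-filter P? xs)
    ... | false = length-filter P? xs

    cnt-↭ : ∀ (p : A → Bool) {xs ys} → xs ↭ ys → cnt p xs ≡ cnt p ys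
    cnt-↭ p ↭.refl            = refl
    cnt-↭ p (↭.prep x xs↭ys)  = cong (ι (p x) +_) (cnt-↭ p xs↭ys)
    cnt-↭ p {x ∷ y ∷ xs} (↭.swap x y xs↭ys) =
      trans (x∙yz≈y∙xz (ι (p x)) (ι (p y)) (cnt p xs))
        (cong (λ t → ι (p y) + (ι (p x) + t)) (cnt-↭ p xs↭ys))
    cnt-↭ p (↭.trans q r)     = trans (cnt-↭ p q) (cnt-↭ p r)

    cnt-++ : ∀ (p : A → Bool) xs ys → cnt p (xs ++ ys) ≡ cnt p xs + cnt p ys
    cnt-++ p []       ys = refl
    cnt-++ p (x ∷ xs) ys = trans (cong (ι (p x) +_) (cnt-++ p xs ys)) (sym (+-assoc (ι (p x)) _ _))

    cnt-map : ∀ {B : Set} (p : B → Bool) (h : A → B) xs → cnt p (map h xs) ≡ cnt (λ x → p (h x)) xs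
    cnt-map p h []       = refl
    cnt-map p h (x ∷ xs) = cong (ι (p (h x)) +_) (cnt-map p h xs)

    cnt-cong : ∀ (p q : A → Bool) xs → (∀ {x} → x ∈ xs → p x ≡ q x) → cnt p xs ≡ cnt q xs
    cnt-cong p q []       _  = refl
    cnt-cong p q (x ∷ xs) eq = cong₂ _+_ (cong ι (eq (here refl))) (cnt-cong p q xs (λ x∈ → eq (there x∈)))

    cnt-false : (xs : List A) → cnt (λ _ → false) xs ≡ 0
    cnt-false []       = refl
    cnt-false (x ∷ xs) = cnt-false xs

    cnt-split : ∀ (p q : A → Bool) xs →
                cnt p xs ≡ cnt (λ x → not (q x) ∧ p x) xs + cnt (λ x → q x ∧ p x) xs
    cnt-split p q [] = refl
    cnt-split p q (x ∷ xs) with q x | p x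
    ... | true  | true  = trans (cong suc (cnt-split p q xs)) (sym (+-suc _ _))
    ... | true  | false = cnt-split p q xs
    ... | false | true  = cong suc (cnt-split p q xs)
    ... | false | false = cnt-split p q xs

    sum-ι : ∀ (r : A → Bool) xs → sum (map (λ x → ι (r x)) xs) ≡ cnt r xs
    sum-ι r []       = refl
    sum-ι r (x ∷ xs) = cong (ι (r x) +_) (sum-ι r xs)

  cnt-concatMap : ∀ {A B : Set} (p : B → Bool) (g : A → List B) xs →
                  cnt p (concatMap g xs) ≡ sum (map (λ x → cnt p (g x)) xs)
  cnt-concatMap p g []       = refl
  cnt-concatMap p g (x ∷ xs) = trans (cnt-++ p (g x) (concatMap g xs)) (cong (cnt p (g x) +_) (cnt-concatMap p g xs))

  module _ {A B : Set} (g : A → List B) where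

    ∈-concatMap : ∀ xs {z} → z ∈ concatMap g xs → Σ A λ x → x ∈ xs × z ∈ g x
    ∈-concatMap xs z∈ = find (∈-concatMap⁻ g {xs} z∈)

    concatMap-unique : ∀ xs → Unique xs → (∀ {x} → x ∈ xs → Unique (g x)) →
                       (∀ {x y z} → x ∈ xs → y ∈ xs → z ∈ g x → z ∈ g y → x ≡ y) →
                       Unique (concatMap g xs)
    concatMap-unique [] _ _ _ = []
    concatMap-unique (x ∷ xs) (x∉xs ∷ uxs) ug determines =
      Unique.++⁺ (ug (here refl))
        (concatMap-unique xs uxs (λ y∈ → ug (there y∈)) (λ y∈ z∈ → determines (there y∈) (there z∈)))
        disjoint
      where
      disjoint : ∀ {z} → ¬ (z ∈ g x × z ∈ concatMap g xs)
      disjoint (z∈gx , z∈rest) with ∈-concatMap xs z∈rest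
      ... | y , y∈xs , z∈gy = All.lookup x∉xs y∈xs (determines (here refl) (there y∈xs) z∈gx z∈gy)

  words-∈⁻ : ∀ n k {w} → w ∈ words n k → length w ≡ k × All (_< n) w
  words-∈⁻ n zero    (here refl) = refl , []
  words-∈⁻ n (suc k) w∈ with ∈-concatMap (λ a → map (toℕ a ∷_) (words n k)) (allFin n) w∈
  ... | a , _ , w∈a with ∈-map⁻ (toℕ a ∷_) w∈a
  ... | w′ , w′∈ , refl with words-∈⁻ n k w′∈
  ... | len , bounded = cong suc len , toℕ<n a ∷ bounded

  words-∈⁺ : ∀ n k w → length w ≡ k → All (_< n) w → w ∈ words n k
  words-∈⁺ n zero    []      refl []             = here refl
  words-∈⁺ n (suc k) (x ∷ w) len  (x<n ∷ bounded) =
    subst (λ t → t ∷ w ∈ words n (suc k)) (toℕ-fromℕ< x<n)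
      (∈-concatMap⁺ (λ a → map (toℕ a ∷_) (words n k))
        (lose (∈-allFin (fromℕ< x<n))
          (∈-map⁺ (toℕ (fromℕ< x<n) ∷_) (words-∈⁺ n k w (suc-injective len) bounded))))

  ∷-injectiveʳ : ∀ {a b : ℕ} {v w : List ℕ} → a ∷ v ≡ b ∷ w → v ≡ w
  ∷-injectiveʳ refl = refl

  ∷-injectiveˡ : ∀ {a b : ℕ} {v w : List ℕ} → a ∷ v ≡ b ∷ w → a ≡ b
  ∷-injectiveˡ refl = refl

  words-unique : ∀ n k → Unique (words n k)
  words-unique n zero    = [] ∷ []
  words-unique n (suc k) =
    concatMap-unique (λ a → map (toℕ a ∷_) (words n k)) (allFin n) (Unique.allFin⁺ n)
      (λ _ → Unique.map⁺ ∷-injectiveʳ (words-unique n k)) head-determines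
    where
    head-determines : ∀ {a b z} → a ∈ allFin n → b ∈ allFin n →
                      z ∈ map (toℕ a ∷_) (words n k) → z ∈ map (toℕ b ∷_) (words n k) → a ≡ b
    head-determines {a} {b} _ _ z∈a z∈b with ∈-map⁻ (toℕ a ∷_) z∈a | ∈-map⁻ (toℕ b ∷_) z∈b
    ... | _ , _ , refl | _ , _ , eq = toℕ-injective (∷-injectiveˡ eq)

  record IsPermutation (n : ℕ) (w : List ℕ) : Set where
    field
      length≡ : length w ≡ n
      bounded : All (_< n) w
      once    : ∀ a → a < n → occ a w ≡ 1
  open IsPermutation

  perms-∈⁻ : ∀ n {w} → w ∈ perms n → IsPermutation n w
  perms-∈⁻ n {w} w∈ with ∈-filter⁻ (isPerm? n) w∈
  ... | w∈words , isPerm = record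
    { length≡ = proj₁ (words-∈⁻ n n w∈words)
    ; bounded = proj₂ (words-∈⁻ n n w∈words)
    ; once    = λ a a<n → subst (λ t → occ t w ≡ 1) (toℕ-fromℕ< a<n) (All.lookup isPerm (∈-allFin (fromℕ< a<n)))
    }

  perms-∈⁺ : ∀ n {w} → IsPermutation n w → w ∈ perms n
  perms-∈⁺ n {w} w-perm =
    ∈-filter⁺ (isPerm? n) (words-∈⁺ n n w (length≡ w-perm) (bounded w-perm))
      (All.tabulate (λ {a} _ → once w-perm (toℕ a) (toℕ<n a)))

  perms-unique : ∀ n → Unique (perms n)
  perms-unique n = Unique.filter⁺ (isPerm? n) (words-unique n n)

  occ-here : ∀ a w → occ a (a ∷ w) ≡ suc (occ a w)
  occ-here a w rewrite ≡ᵇ-refl a = refl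

  occ-there : ∀ a v w → v ≢ a → occ a (v ∷ w) ≡ occ a w
  occ-there a v w v≢a rewrite ≡ᵇ-≢ v≢a = refl

  occ-absent : ∀ a w → All (_≢ a) w → occ a w ≡ 0
  occ-absent a []      []            = refl
  occ-absent a (x ∷ w) (x≢a ∷ w≢a) = trans (occ-there a x w x≢a) (occ-absent a w w≢a)

  occ-zero : ∀ a w → occ a w ≡ 0 → All (_≢ a) w
  occ-zero a []      _ = []
  occ-zero a (x ∷ w) h with x ≡ᵇ a | ≡ᵇ-reflects x a
  ... | .true  | ofʸ _   = ⊥-elim (1+n≢0 h)
  ... | .false | ofⁿ x≢a = x≢a ∷ occ-zero a w h

  occ-swap : ∀ a u v w → occ a (u ∷ v ∷ w) ≡ occ a (v ∷ u ∷ w)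
  occ-swap a u v w with u ≡ᵇ a | v ≡ᵇ a
  ... | true  | true  = refl
  ... | true  | false = refl
  ... | false | true  = refl
  ... | false | false = refl

  occ-∷ : ∀ a x {v w} → occ a v ≡ occ a w → occ a (x ∷ v) ≡ occ a (x ∷ w)
  occ-∷ a x eq with x ≡ᵇ a
  ... | true  = cong suc eq
  ... | false = eq

  ins : ℕ → List ℕ → List (List ℕ)
  ins v []       = (v ∷ []) ∷ []
  ins v (y ∷ ys) = (v ∷ y ∷ ys) ∷ map (y ∷_) (ins v ys)

  rm : ℕ → List ℕ → List ℕ
  rm v []       = []
  rm v (x ∷ xs) = if x ≡ᵇ v then xs else x ∷ rm v xs

  ins-length : ∀ v ys {w} → w ∈ ins v ys → length w ≡ suc (length ys)
  ins-length v []       (here refl) = refl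
  ins-length v (y ∷ ys) (here refl) = refl
  ins-length v (y ∷ ys) (there w∈) with ∈-map⁻ (y ∷_) w∈
  ... | _ , w′∈ , refl = cong suc (ins-length v ys w′∈)

  ins-All⁺ : ∀ {P : ℕ → Set} v ys {w} → P v → All P ys → w ∈ ins v ys → All P w
  ins-All⁺ v []       pv []        (here refl) = pv ∷ []
  ins-All⁺ v (y ∷ ys) pv all       (here refl) = pv ∷ all
  ins-All⁺ v (y ∷ ys) pv (py ∷ all) (there w∈) with ∈-map⁻ (y ∷_) w∈
  ... | _ , w′∈ , refl = py ∷ ins-All⁺ v ys pv all w′∈

  ins-All⁻ : ∀ {P : ℕ → Set} v ys {w} → w ∈ ins v ys → All P w → All P ys
  ins-All⁻ v []       (here refl) _          = []
  ins-All⁻ v (y ∷ ys) (here refl) (_ ∷ all)  = all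
  ins-All⁻ v (y ∷ ys) (there w∈)  all with ∈-map⁻ (y ∷_) w∈
  ins-All⁻ v (y ∷ ys) (there w∈)  (py ∷ all) | _ , w′∈ , refl = py ∷ ins-All⁻ v ys w′∈ all

  ins-occ : ∀ a v ys {w} → w ∈ ins v ys → occ a w ≡ occ a (v ∷ ys)
  ins-occ a v []       (here refl) = refl
  ins-occ a v (y ∷ ys) (here refl) = refl
  ins-occ a v (y ∷ ys) (there w∈) with ∈-map⁻ (y ∷_) w∈
  ... | w′ , w′∈ , refl = trans (occ-∷ a y {w′} {v ∷ ys} (ins-occ a v ys w′∈)) (occ-swap a y v ys)

  rm-ins : ∀ v ys {w} → All (_≢ v) ys → w ∈ ins v ys → rm v w ≡ ys
  rm-ins v []       _ (here refl) rewrite ≡ᵇ-refl v = refl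
  rm-ins v (y ∷ ys) _ (here refl) rewrite ≡ᵇ-refl v = refl
  rm-ins v (y ∷ ys) (y≢v ∷ ys≢v) (there w∈) with ∈-map⁻ (y ∷_) w∈
  ... | _ , w′∈ , refl rewrite ≡ᵇ-≢ y≢v = cong (y ∷_) (rm-ins v ys ys≢v w′∈)

  ins-rm : ∀ v w → 1 ≤ occ v w → w ∈ ins v (rm v w)
  ins-rm v []       ()
  ins-rm v (x ∷ xs) h with x ≡ᵇ v | ≡ᵇ-reflects x v
  ins-rm v (x ∷ [])     h | .true  | ofʸ refl = here refl
  ins-rm v (x ∷ y ∷ xs) h | .true  | ofʸ refl = here refl
  ...                     | .false | ofⁿ _    = there (∈-map⁺ (x ∷_) (ins-rm v xs h))

  ins-unique : ∀ v ys → All (_≢ v) ys → Unique (ins v ys)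
  ins-unique v []       _            = [] ∷ []
  ins-unique v (y ∷ ys) (y≢v ∷ ys≢v) =
    All.tabulate (λ w∈ → front-differs w∈) ∷ Unique.map⁺ ∷-injectiveʳ (ins-unique v ys ys≢v)
    where
    front-differs : ∀ {w} → w ∈ map (y ∷_) (ins v ys) → v ∷ y ∷ ys ≢ w
    front-differs w∈ eq with ∈-map⁻ (y ∷_) w∈
    front-differs w∈ refl | _ , _ , refl = y≢v refl

  remove-top : ∀ n {w} → IsPermutation (suc n) w →
               IsPermutation n (rm n w) × w ∈ ins n (rm n w)
  remove-top n {w} w-perm = π-perm , w∈
    where
    π = rm n w
    w∈ : w ∈ ins n π
    w∈ = ins-rm n w (subst (1 ≤_) (sym (once w-perm n ≤-refl)) ≤-refl)
    n∉π : occ n π ≡ 0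
    n∉π = suc-injective (trans (sym (occ-here n π)) (trans (sym (ins-occ n n π w∈)) (once w-perm n ≤-refl)))
    π-perm : IsPermutation n π
    π-perm = record
      { length≡ = suc-injective (trans (sym (ins-length n π w∈)) (length≡ w-perm))
      ; bounded = All.zipWith (λ (x≤n , x≢n) → ≤∧≢⇒< (≤-pred x≤n) x≢n)
                    (ins-All⁻ n π w∈ (bounded w-perm) , occ-zero n π n∉π)
      ; once    = λ a a<n → trans (sym (occ-there a n π (>⇒≢ a<n)))
                                  (trans (sym (ins-occ a n π w∈)) (once w-perm a (m<n⇒m<1+n a<n)))
      }

  insert-top : ∀ n {π w} → IsPermutation n π → w ∈ ins n π → IsPermutation (suc n) w
  insert-top n {π} {w} π-perm w∈ = record
    { length≡ = trans (ins-length n π w∈) (cong suc (length≡ π-perm))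
    ; bounded = ins-All⁺ n π ≤-refl (All.map m<n⇒m<1+n (bounded π-perm)) w∈
    ; once    = once-w
    }
    where
    once-w : ∀ a → a < suc n → occ a w ≡ 1
    once-w a a<1+n with n ≟ a
    ... | yes refl = trans (ins-occ a n π w∈)
                       (trans (occ-here a π) (cong suc (occ-absent a π (All.map <⇒≢ (bounded π-perm)))))
    ... | no n≢a   = trans (ins-occ a n π w∈)
                       (trans (occ-there a n π n≢a) (once π-perm a (≤∧≢⇒< (≤-pred a<1+n) (≢-sym n≢a))))

  perms-insert : ∀ n → perms (suc n) ↭ concatMap (ins n) (perms n)
  perms-insert n = ∼bag⇒↭ (unique∧set⇒bag (perms-unique (suc n))
    (concatMap-unique (ins n) (perms n) (perms-unique n)
      (λ π∈ → ins-unique n _ (below π∈))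
      (λ π∈ σ∈ w∈π w∈σ → trans (sym (rm-ins n _ (below π∈) w∈π)) (rm-ins n _ (below σ∈) w∈σ)))
    (mk⇔ to from))
    where
    below : ∀ {π} → π ∈ perms n → All (_≢ n) π
    below π∈ = All.map <⇒≢ (bounded (perms-∈⁻ n π∈))
    to : ∀ {w} → w ∈ perms (suc n) → w ∈ concatMap (ins n) (perms n)
    to w∈ with remove-top n (perms-∈⁻ (suc n) w∈)
    ... | π-perm , w∈ins = ∈-concatMap⁺ (ins n) (lose (perms-∈⁺ n π-perm) w∈ins)
    from : ∀ {w} → w ∈ concatMap (ins n) (perms n) → w ∈ perms (suc n)
    from w∈ with ∈-concatMap (ins n) (perms n) w∈
    ... | π , π∈ , w∈ins = perms-∈⁺ (suc n) (insert-top n (perms-∈⁻ n π∈) w∈ins)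

  -- Adjacencies between two boundaries.  `adjFrom s ys b` counts the
  -- adjacencies of the sequence  s-1, ys, b  (an entry equal to its
  -- predecessor plus one); the left boundary enters only through its
  -- successor s, so s = 0 encodes the imagined entry -1.
  adjFrom : ℕ → List ℕ → ℕ → ℕ
  adjFrom s []       b = ι (b ≡ᵇ s)
  adjFrom s (y ∷ ys) b = ι (y ≡ᵇ s) + adjFrom (suc y) ys b

  adj4-adjFrom : ∀ m w → adj4 (suc m) w ≡ adjFrom 0 w (suc m)
  adj4-adjFrom m []       = refl
  adj4-adjFrom m (x ∷ xs) = trans (cong (_+ ι (x ≡ᵇ 0)) (inner+back x xs)) (+-comm _ (ι (x ≡ᵇ 0)))
    where
    inner+back : ∀ x xs → inner (x ∷ xs) + back (suc m) (x ∷ xs) ≡ adjFrom (suc x) xs (suc m)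
    inner+back x []       = cong ι (≡ᵇ-sym x m)
    inner+back x (y ∷ ys) = trans (+-assoc (ι (y ≡ᵇ suc x)) (inner (y ∷ ys)) _)
                                  (cong (ι (y ≡ᵇ suc x) +_) (inner+back y ys))

  -- The interior gaps of ys (the gap before each entry y, whose predecessor
  -- has successor s) classified by the effect of inserting a symbol v there:
  -- the gap lies inside an adjacency, which the insertion breaks; or it
  -- follows v-1, so that the insertion joins v-1 and v; or neither.
  data GapKind : Set where
    breaks joins neutral : GapKind

  gapKind : ℕ → ℕ → ℕ → GapKind
  gapKind v s y = if y ≡ᵇ s then breaks else (if v ≡ᵇ s then joins else neutral)

  gapKinds : ℕ → ℕ → List ℕ → List GapKind
  gapKinds v s []       = []
  gapKinds v s (y ∷ ys) = gapKind v s y ∷ gapKinds v (suc y) ys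

  isBreak isJoin isNeutral : GapKind → Bool
  isBreak breaks = true
  isBreak _      = false
  isJoin joins = true
  isJoin _     = false
  isNeutral neutral = true
  isNeutral _       = false

  -- Whether the last entry (the left boundary, if ys is empty) is v-1; the
  -- final gap then joins as well.
  endsBelow : ℕ → ℕ → List ℕ → Bool
  endsBelow v s []       = v ≡ᵇ s
  endsBelow v s (y ∷ ys) = endsBelow v (suc y) ys

  isBreak-gapKind : ∀ v s y → isBreak (gapKind v s y) ≡ (y ≡ᵇ s)
  isBreak-gapKind v s y with y ≡ᵇ s | v ≡ᵇ s
  ... | true  | _     = refl
  ... | false | true  = refl
  ... | false | false = refl

  gapKinds-length : ∀ v s ys → length (gapKinds v s ys) ≡ length ys
  gapKinds-length v s []       = refl
  gapKinds-length v s (y ∷ ys) = cong suc (gapKinds-length v (suc y) ys)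

  kinds-partition : ∀ κs → cnt isBreak κs + cnt isJoin κs + cnt isNeutral κs ≡ length κs
  kinds-partition []             = refl
  kinds-partition (breaks ∷ κs)  = cong suc (kinds-partition κs)
  kinds-partition (joins ∷ κs)   = trans (cong (_+ cnt isNeutral κs) (+-suc (cnt isBreak κs) _))
                                         (cong suc (kinds-partition κs))
  kinds-partition (neutral ∷ κs) = trans (+-suc _ _) (cong suc (kinds-partition κs))

  adjFrom-kinds : ∀ v s ys → adjFrom s ys v ≡ cnt isBreak (gapKinds v s ys) + ι (endsBelow v s ys)
  adjFrom-kinds v s []       = refl
  adjFrom-kinds v s (y ∷ ys) =
    trans (cong₂ _+_ (cong ι (sym (isBreak-gapKind v s y))) (adjFrom-kinds v (suc y) ys))
          (sym (+-assoc (ι (isBreak (gapKind v s y))) _ _))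

  endsBelow-above : ∀ v s ys → s ≤ v → All (_< v) ys → endsBelow (suc v) s ys ≡ false
  endsBelow-above v s []       s≤v []           = ≡ᵇ-≢ (λ eq → <-irrefl (sym eq) (s≤s s≤v))
  endsBelow-above v s (y ∷ ys) s≤v (y<v ∷ ys<v) = endsBelow-above v (suc y) ys y<v ys<v

  adjFrom-above : ∀ v s ys → s ≤ v → All (_< v) ys → adjFrom s ys (suc v) ≡ cnt isBreak (gapKinds v s ys)
  adjFrom-above v s []       s≤v []           = cong ι (≡ᵇ-≢ (λ eq → <-irrefl (sym eq) (s≤s s≤v)))
  adjFrom-above v s (y ∷ ys) s≤v (y<v ∷ ys<v) =
    cong₂ _+_ (cong ι (sym (isBreak-gapKind v s y))) (adjFrom-above v (suc y) ys y<v ys<v)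

  occ-ι : ∀ a y ys → occ a (y ∷ ys) ≡ ι (y ≡ᵇ a) + occ a ys
  occ-ι a y ys with y ≡ᵇ a
  ... | true  = refl
  ... | false = refl

  joins-occ : ∀ u s ys → All (_< suc u) ys →
              cnt isJoin (gapKinds (suc u) s ys) + ι (endsBelow (suc u) s ys) ≡ ι (suc u ≡ᵇ s) + occ u ys
  joins-occ u s []       []              = +-comm 0 _
  joins-occ u s (y ∷ ys) (y<1+u ∷ ys<1+u) = begin
    ι (isJoin κ) + cnt isJoin κs + ι e                 ≡⟨ +-assoc (ι (isJoin κ)) _ _ ⟩
    ι (isJoin κ) + (cnt isJoin κs + ι e)               ≡⟨ cong (ι (isJoin κ) +_) (joins-occ u (suc y) ys ys<1+u) ⟩
    ι (isJoin κ) + (ι (u ≡ᵇ y) + occ u ys)             ≡⟨ +-assoc (ι (isJoin κ)) _ _ ⟨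
    ι (isJoin κ) + ι (u ≡ᵇ y) + occ u ys               ≡⟨ cong (_+ occ u ys) join-or-occurrence ⟩
    ι (suc u ≡ᵇ s) + ι (y ≡ᵇ u) + occ u ys             ≡⟨ +-assoc (ι (suc u ≡ᵇ s)) _ _ ⟩
    ι (suc u ≡ᵇ s) + (ι (y ≡ᵇ u) + occ u ys)           ≡⟨ cong (ι (suc u ≡ᵇ s) +_) (occ-ι u y ys) ⟨
    ι (suc u ≡ᵇ s) + occ u (y ∷ ys)                    ∎
    where
    open ≡-Reasoning
    κ  = gapKind (suc u) s y
    κs = gapKinds (suc u) (suc y) ys
    e  = endsBelow (suc u) (suc y) ys
    -- If the gap before y breaks (y = s), then s ≠ u+1 as y ≤ u; otherwise
    -- it joins exactly when its left neighbour is u (s = u+1).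
    join-or-occurrence : ι (isJoin κ) + ι (u ≡ᵇ y) ≡ ι (suc u ≡ᵇ s) + ι (y ≡ᵇ u)
    join-or-occurrence with y ≡ᵇ s | ≡ᵇ-reflects y s
    ... | .true  | ofʸ refl rewrite ≡ᵇ-≢ (λ eq → <-irrefl (sym eq) y<1+u) = cong ι (≡ᵇ-sym u y)
    ... | .false | ofⁿ _ with suc u ≡ᵇ s
    ...   | true  = cong (1 +_) (cong ι (≡ᵇ-sym u y))
    ...   | false = cong ι (≡ᵇ-sym u y)

  profile : ℕ → ℕ → List ℕ → ℕ × Bool
  profile v s w = adjFrom s w (suc v) , endsBelow (suc v) s w

  -- Inserting v into an interior gap of a given kind changes A
  -- adjacencies into A-1, A+1 or A, and v is not last afterwards.
  interior : ℕ → GapKind → ℕ × Bool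
  interior A breaks  = pred A , false
  interior A joins   = suc A , false
  interior A neutral = A , false

  -- Prepending y shifts the adjacency count by the possible adjacency at y.
  shiftBy : ℕ → ℕ × Bool → ℕ × Bool
  shiftBy e (a , b) = e + a , b

  shift-interior : ∀ e A κs → cnt isBreak κs ≤ A →
                   map (shiftBy e) (map (interior A) κs) ≡ map (interior (e + A)) κs
  shift-interior e A       []             _ = refl
  shift-interior e (suc A) (breaks ∷ κs)  (s≤s h) =
    cong₂ _∷_ (cong (λ t → pred t , false) (sym (+-suc e A))) (shift-interior e (suc A) κs (m≤n⇒m≤1+n h))
  shift-interior e A       (joins ∷ κs)   h = cong₂ _∷_ (cong (_, false) (+-suc e A)) (shift-interior e A κs h)
  shift-interior e A       (neutral ∷ κs) h = cong (_ ∷_) (shift-interior e A κs h)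

  insertion-profiles : ∀ v s ys → s ≤ v → All (_< v) ys →
    let A = cnt isBreak (gapKinds v s ys) in
    map (profile v s) (ins v ys) ≡ map (interior A) (gapKinds v s ys) ++ ((A + ι (endsBelow v s ys) + 1 , true) ∷ [])
  insertion-profiles v s []       s≤v []           rewrite ≡ᵇ-refl v = refl
  insertion-profiles v s (y ∷ ys) s≤v (y<v ∷ ys<v) rewrite isBreak-gapKind v s y =
    cong₂ _∷_ at-head at-tail
    where
    A′ = cnt isBreak (gapKinds v (suc y) ys)
    e  = ι (y ≡ᵇ s)
    at-head : profile v s (v ∷ y ∷ ys) ≡ interior (e + A′) (gapKind v s y)
    at-head rewrite ≡ᵇ-≢ {y} {suc v} (λ eq → <-irrefl eq (m<n⇒m<1+n y<v))
                | adjFrom-above v (suc y) ys y<v ys<v | endsBelow-above v (suc y) ys y<v ys<v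
      with y ≡ᵇ s | ≡ᵇ-reflects y s
    ... | .true  | ofʸ refl rewrite ≡ᵇ-≢ {v} {y} (λ eq → <-irrefl (sym eq) y<v) = refl
    ... | .false | ofⁿ _ with v ≡ᵇ s
    ...   | true  = refl
    ...   | false = refl
    at-tail : map (profile v s) (map (y ∷_) (ins v ys)) ≡
           map (interior (e + A′)) (gapKinds v (suc y) ys) ++ ((e + A′ + ι (endsBelow v (suc y) ys) + 1 , true) ∷ [])
    at-tail = begin
      map (profile v s) (map (y ∷_) (ins v ys))
        ≡⟨ map-∘ (ins v ys) ⟨
      map (shiftBy e ∘ profile v (suc y)) (ins v ys)
        ≡⟨ map-∘ (ins v ys) ⟩
      map (shiftBy e) (map (profile v (suc y)) (ins v ys))
        ≡⟨ cong (map (shiftBy e)) (insertion-profiles v (suc y) ys y<v ys<v) ⟩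
      map (shiftBy e) (map (interior A′) (gapKinds v (suc y) ys) ++ _)
        ≡⟨ map-++ (shiftBy e) (map (interior A′) (gapKinds v (suc y) ys)) _ ⟩
      map (shiftBy e) (map (interior A′) (gapKinds v (suc y) ys)) ++ _
        ≡⟨ cong₂ _++_ (shift-interior e A′ (gapKinds v (suc y) ys) ≤-refl)
                      (cong (λ t → (t , true) ∷ []) (+-assoc-shift e A′ _)) ⟩
      _ ∎
      where
      open ≡-Reasoning
      +-assoc-shift : ∀ e a b → e + (a + b + 1) ≡ e + a + b + 1
      +-assoc-shift e a b = trans (sym (+-assoc e (a + b) 1)) (cong (_+ 1) (sym (+-assoc e a b)))

  ends : ℕ → List ℕ → Bool
  ends n π = endsBelow n 0 π

  -- The symbol u occurs once, so
  -- either some interior gap joins or π ends in u; there are n interior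
  -- gaps; and the type 4 adjacencies are the breaking gaps plus the
  -- right-boundary adjacency.
  module GapStatistics (u : ℕ) (π : List ℕ) (π∈ : π ∈ perms (suc u)) where
    n  = suc u
    κs = gapKinds n 0 π
    A  = cnt isBreak κs
    J  = cnt isJoin κs
    N  = cnt isNeutral κs
    π-perm = perms-∈⁻ n π∈

    joins+end : J + ι (ends n π) ≡ 1
    joins+end = trans (joins-occ u 0 π (bounded π-perm)) (once π-perm u ≤-refl)

    gaps : A + J + N ≡ n
    gaps = trans (kinds-partition κs) (trans (gapKinds-length n 0 π) (length≡ π-perm))

    adjacencies : adj4 n π ≡ A + ι (ends n π)
    adjacencies = trans (adj4-adjFrom u π) (adjFrom-kinds n 0 π)

    insertions : ∀ (P : ℕ × Bool → Bool) →
                 cnt (λ w → P (adj4 (suc n) w , ends (suc n) w)) (ins n π) ≡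
                 cnt P (map (interior A) κs) + ι (P (suc (adj4 n π) , true))
    insertions P = begin
      cnt (λ w → P (adj4 (suc n) w , ends (suc n) w)) (ins n π)
        ≡⟨ cnt-cong _ (P ∘ profile n 0) (ins n π)
             (λ {w} _ → cong (λ a → P (a , ends (suc n) w)) (adj4-adjFrom n w)) ⟩
      cnt (P ∘ profile n 0) (ins n π)
        ≡⟨ cnt-map P (profile n 0) (ins n π) ⟨
      cnt P (map (profile n 0) (ins n π))
        ≡⟨ cong (cnt P) (insertion-profiles n 0 π z≤n (bounded π-perm)) ⟩
      cnt P (map (interior A) κs ++ ((A + ι (ends n π) + 1 , true) ∷ []))
        ≡⟨ cnt-++ P (map (interior A) κs) _ ⟩
      cnt P (map (interior A) κs) + (ι (P (A + ι (ends n π) + 1 , true)) + 0)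
        ≡⟨ cong (cnt P (map (interior A) κs) +_) (trans (+-identityʳ _) (cong (λ k → ι (P (k , true))) final)) ⟩
      cnt P (map (interior A) κs) + ι (P (suc (adj4 n π) , true)) ∎
      where
      open ≡-Reasoning
      final : A + ι (ends n π) + 1 ≡ suc (adj4 n π)
      final = trans (+-comm _ 1) (cong suc (sym adjacencies))

  interior-exact : ∀ A j κs → cnt (λ p → proj₁ p ≡ᵇ j) (map (interior A) κs) ≡
    cnt isBreak κs * ι (pred A ≡ᵇ j) + cnt isJoin κs * ι (suc A ≡ᵇ j) + cnt isNeutral κs * ι (A ≡ᵇ j)
  interior-exact A j []             = refl
  interior-exact A j (breaks ∷ κs)  rewrite interior-exact A j κs =
    lemma (ι (pred A ≡ᵇ j)) (ι (suc A ≡ᵇ j)) (ι (A ≡ᵇ j)) (cnt isBreak κs) (cnt isJoin κs) (cnt isNeutral κs)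
    where
    lemma : ∀ x y z a b c → x + (a * x + b * y + c * z) ≡ (x + a * x) + b * y + c * z
    lemma = solve-∀
  interior-exact A j (joins ∷ κs)   rewrite interior-exact A j κs =
    lemma (ι (pred A ≡ᵇ j)) (ι (suc A ≡ᵇ j)) (ι (A ≡ᵇ j)) (cnt isBreak κs) (cnt isJoin κs) (cnt isNeutral κs)
    where
    lemma : ∀ x y z a b c → y + (a * x + b * y + c * z) ≡ a * x + (y + b * y) + c * z
    lemma = solve-∀
  interior-exact A j (neutral ∷ κs) rewrite interior-exact A j κs =
    lemma (ι (pred A ≡ᵇ j)) (ι (suc A ≡ᵇ j)) (ι (A ≡ᵇ j)) (cnt isBreak κs) (cnt isJoin κs) (cnt isNeutral κs)
    where
    lemma : ∀ x y z a b c → z + (a * x + b * y + c * z) ≡ a * x + b * y + (z + c * z)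
    lemma = solve-∀

  interior-ending : ∀ (q : ℕ → Bool) A κs → cnt (λ p → proj₂ p ∧ q (proj₁ p)) (map (interior A) κs) ≡ 0
  interior-ending q A []             = refl
  interior-ending q A (breaks ∷ κs)  = interior-ending q A κs
  interior-ending q A (joins ∷ κs)   = interior-ending q A κs
  interior-ending q A (neutral ∷ κs) = interior-ending q A κs

  exact-insertions : ℕ → List ℕ → ℕ → ℕ
  exact-insertions n π j = cnt (λ w → adj4 (suc n) w ≡ᵇ j) (ins n π)

  -- If π does not end in
  -- n-1, it has A adjacencies; the n-1+1 = n interior gaps are A breaking,
  -- N neutral and one joining, and the final gap adds one adjacency.  If π
  -- ends in n-1, it has A+1 adjacencies (the last one is lost by every
  -- interior insertion) and no interior gap joins.
  data InsertionCounts (n : ℕ) (π : List ℕ) : Set where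
    not-ending : ∀ A N → ends n π ≡ false → adj4 n π ≡ A → A + suc N ≡ n →
      (∀ j → exact-insertions n π j ≡ A * ι (pred A ≡ᵇ j) + N * ι (A ≡ᵇ j) + 2 * ι (suc A ≡ᵇ j)) →
      InsertionCounts n π
    ending : ∀ A N → ends n π ≡ true → adj4 n π ≡ suc A → A + N ≡ n →
      (∀ j → exact-insertions n π j ≡ A * ι (pred A ≡ᵇ j) + N * ι (A ≡ᵇ j) + ι (suc (suc A) ≡ᵇ j)) →
      InsertionCounts n π

  insertion-counts : ∀ u π → π ∈ perms (suc u) → InsertionCounts (suc u) π
  insertion-counts u π π∈ = classify (ends n π) refl
    where
    open GapStatistics u π π∈
    open ≡-Reasoning

    exact : ∀ j → exact-insertions n π j ≡
            A * ι (pred A ≡ᵇ j) + J * ι (suc A ≡ᵇ j) + N * ι (A ≡ᵇ j) + ι (suc (adj4 n π) ≡ᵇ j)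
    exact j = trans (insertions (λ p → proj₁ p ≡ᵇ j))
                    (cong (_+ ι (suc (adj4 n π) ≡ᵇ j)) (interior-exact A j κs))

    classify : ∀ l → ends n π ≡ l → InsertionCounts n π
    classify false e = not-ending A N e adj-count size count
      where
      J≡1 : J ≡ 1
      J≡1 = trans (sym (+-identityʳ J)) (subst (λ b → J + ι b ≡ 1) e joins+end)
      adj-count : adj4 n π ≡ A
      adj-count = trans adjacencies (trans (cong (λ b → A + ι b) e) (+-identityʳ A))
      size : A + suc N ≡ n
      size = trans (sym (+-assoc A 1 N)) (subst (λ c → A + c + N ≡ n) J≡1 gaps)
      count : ∀ j → exact-insertions n π j ≡ A * ι (pred A ≡ᵇ j) + N * ι (A ≡ᵇ j) + 2 * ι (suc A ≡ᵇ j)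
      count j = begin
        exact-insertions n π j
          ≡⟨ exact j ⟩
        A * ι (pred A ≡ᵇ j) + J * ι (suc A ≡ᵇ j) + N * ι (A ≡ᵇ j) + ι (suc (adj4 n π) ≡ᵇ j)
          ≡⟨ cong₂ (λ c k → A * ι (pred A ≡ᵇ j) + c * ι (suc A ≡ᵇ j) + N * ι (A ≡ᵇ j) + ι (suc k ≡ᵇ j))
                   J≡1 adj-count ⟩
        A * ι (pred A ≡ᵇ j) + 1 * ι (suc A ≡ᵇ j) + N * ι (A ≡ᵇ j) + ι (suc A ≡ᵇ j)
          ≡⟨ lemma (A * ι (pred A ≡ᵇ j)) (N * ι (A ≡ᵇ j)) (ι (suc A ≡ᵇ j)) ⟩
        A * ι (pred A ≡ᵇ j) + N * ι (A ≡ᵇ j) + 2 * ι (suc A ≡ᵇ j) ∎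
        where
        lemma : ∀ a b y → a + 1 * y + b + y ≡ a + b + 2 * y
        lemma = solve-∀
    classify true e = ending A N e adj-count size count
      where
      J≡0 : J ≡ 0
      J≡0 = suc-injective (trans (+-comm 1 J) (subst (λ b → J + ι b ≡ 1) e joins+end))
      adj-count : adj4 n π ≡ suc A
      adj-count = trans adjacencies (trans (cong (λ b → A + ι b) e) (+-comm A 1))
      size : A + N ≡ n
      size = trans (cong (_+ N) (sym (+-identityʳ A))) (subst (λ c → A + c + N ≡ n) J≡0 gaps)
      count : ∀ j → exact-insertions n π j ≡ A * ι (pred A ≡ᵇ j) + N * ι (A ≡ᵇ j) + ι (suc (suc A) ≡ᵇ j)
      count j = begin
        exact-insertions n π j
          ≡⟨ exact j ⟩
        A * ι (pred A ≡ᵇ j) + J * ι (suc A ≡ᵇ j) + N * ι (A ≡ᵇ j) + ι (suc (adj4 n π) ≡ᵇ j)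
          ≡⟨ cong₂ (λ c k → A * ι (pred A ≡ᵇ j) + c * ι (suc A ≡ᵇ j) + N * ι (A ≡ᵇ j) + ι (suc k ≡ᵇ j))
                   J≡0 adj-count ⟩
        A * ι (pred A ≡ᵇ j) + 0 * ι (suc A ≡ᵇ j) + N * ι (A ≡ᵇ j) + ι (suc (suc A) ≡ᵇ j)
          ≡⟨ lemma (A * ι (pred A ≡ᵇ j)) (ι (suc A ≡ᵇ j)) (N * ι (A ≡ᵇ j)) (ι (suc (suc A) ≡ᵇ j)) ⟩
        A * ι (pred A ≡ᵇ j) + N * ι (A ≡ᵇ j) + ι (suc (suc A) ≡ᵇ j) ∎
        where
        lemma : ∀ a x b y → a + 0 * x + b + y ≡ a + b + y
        lemma = solve-∀

  -- Only the insertion at the very end ends in n, and it has one adjacency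
  -- more than π.
  ending-insertions : ∀ u π → π ∈ perms (suc u) → ∀ (q : ℕ → Bool) →
    cnt (λ w → ends (suc (suc u)) w ∧ q (adj4 (suc (suc u)) w)) (ins (suc u) π) ≡ ι (q (suc (adj4 (suc u) π)))
  ending-insertions u π π∈ q =
    trans (insertions (λ p → proj₂ p ∧ q (proj₁ p)))
          (cong (_+ ι (q (suc (adj4 n π)))) (interior-ending q A κs))
    where open GapStatistics u π π∈

  count-by-insertion : ∀ n (p : List ℕ → Bool) →
    cnt p (perms (suc n)) ≡ sum (map (λ π → cnt p (ins n π)) (perms n))
  count-by-insertion n p = trans (cnt-↭ p (perms-insert n)) (cnt-concatMap p (ins n) (perms n))

  -- Deleting the final n-1 identifies the permutations of {0,…,n-1}
  -- ending in n-1 with the permutations of {0,…,n-2}, and costs exactly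
  -- one adjacency.
  ending-count : ∀ u (q : ℕ → Bool) →
    cnt (λ w → ends (suc (suc u)) w ∧ q (adj4 (suc (suc u)) w)) (perms (suc (suc u))) ≡
    cnt (λ π → q (suc (adj4 (suc u) π))) (perms (suc u))
  ending-count u q =
    trans (count-by-insertion (suc u) _)
      (trans (cong sum (map-cong-local (All.tabulate (λ π∈ → ending-insertions u _ π∈ q))))
        (sum-ι (λ π → q (suc (adj4 (suc u) π))) (perms (suc u))))

open import Defs
open import Data.Nat as ℕ using (ℕ; zero; suc; pred; _≤_; _∸_; s≤s; _≡ᵇ_)
import Data.Nat.Properties as ℕ
open import Data.Nat.ListAction using (sum)
open import Data.Bool using (Bool; true; false; not; _∧_)
open import Data.List using (List; []; _∷_; map)
open import Data.List.Membership.Propositional using (_∈_)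
open import Data.List.Relation.Unary.Any using (here; there)
open import Data.Product using (_×_; _,_)
open import Relation.Nullary.Reflects using (ofʸ; ofⁿ)
open import Relation.Binary.PropositionalEquality using (_≡_; refl; sym; trans; cong; cong₂; module ≡-Reasoning)
open import Data.Integer using (ℤ; +_; _+_; _-_; _*_)
import Data.Integer.Properties as ℤ
open import Data.Integer.Tactic.RingSolver using (solve-∀)
open Insertion

module _ {A : Set} where

  Σℤ : (A → ℤ) → List A → ℤ
  Σℤ g []       = + 0
  Σℤ g (x ∷ xs) = g x + Σℤ g xs

  Σℤ-cong : ∀ (g h : A → ℤ) xs → (∀ {x} → x ∈ xs → g x ≡ h x) → Σℤ g xs ≡ Σℤ h xs
  Σℤ-cong g h []       _  = refl
  Σℤ-cong g h (x ∷ xs) eq = cong₂ _+_ (eq (here refl)) (Σℤ-cong g h xs (λ x∈ → eq (there x∈)))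

  Σℤ-zero : ∀ xs → Σℤ (λ _ → + 0) xs ≡ + 0
  Σℤ-zero []       = refl
  Σℤ-zero (x ∷ xs) = trans (ℤ.+-identityˡ _) (Σℤ-zero xs)

  Σℤ-+ : ∀ (g h : A → ℤ) xs → Σℤ (λ x → g x + h x) xs ≡ Σℤ g xs + Σℤ h xs
  Σℤ-+ g h []       = refl
  Σℤ-+ g h (x ∷ xs) rewrite Σℤ-+ g h xs = lemma (g x) (h x) (Σℤ g xs) (Σℤ h xs)
    where
    lemma : ∀ a b c d → a + b + (c + d) ≡ a + c + (b + d)
    lemma = solve-∀

  Σℤ-scale : ∀ c (g : A → ℤ) xs → Σℤ (λ x → c * g x) xs ≡ c * Σℤ g xs
  Σℤ-scale c g []       = sym (ℤ.*-zeroʳ c)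
  Σℤ-scale c g (x ∷ xs) = trans (cong (_+_ (c * g x)) (Σℤ-scale c g xs)) (sym (ℤ.*-distribˡ-+ c (g x) (Σℤ g xs)))

  Σℤ-ι : ∀ (p : A → Bool) xs → Σℤ (λ x → + ι (p x)) xs ≡ + cnt p xs
  Σℤ-ι p []       = refl
  Σℤ-ι p (x ∷ xs) = trans (cong (_+_ (+ ι (p x))) (Σℤ-ι p xs)) (sym (ℤ.pos-+ (ι (p x)) (cnt p xs)))

  pos-sum : ∀ (h : A → ℕ) xs → + sum (map h xs) ≡ Σℤ (λ x → + h x) xs
  pos-sum h []       = refl
  pos-sum h (x ∷ xs) = trans (ℤ.pos-+ (h x) (sum (map h xs))) (cong (_+_ (+ h x)) (pos-sum h xs))

Combination : Set → Set
Combination S = List (ℤ × (S → Bool))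

evalC : {S : Set} → Combination S → S → ℤ
evalC []             s = + 0
evalC ((c , p) ∷ cs) s = c * + ι (p s) + evalC cs s

countC : {A S : Set} → Combination S → (A → S) → List A → ℤ
countC []             stat xs = + 0
countC ((c , p) ∷ cs) stat xs = c * + cnt (λ x → p (stat x)) xs + countC cs stat xs

Σℤ-evalC : ∀ {A S : Set} (cs : Combination S) (stat : A → S) xs →
           Σℤ (λ x → evalC cs (stat x)) xs ≡ countC cs stat xs
Σℤ-evalC []             stat xs = Σℤ-zero xs
Σℤ-evalC ((c , p) ∷ cs) stat xs = begin
  Σℤ (λ x → c * + ι (p (stat x)) + evalC cs (stat x)) xs
    ≡⟨ Σℤ-+ (λ x → c * + ι (p (stat x))) (λ x → evalC cs (stat x)) xs ⟩
  Σℤ (λ x → c * + ι (p (stat x))) xs + Σℤ (λ x → evalC cs (stat x)) xs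
    ≡⟨ cong₂ _+_ (trans (Σℤ-scale c (λ x → + ι (p (stat x))) xs) (cong (c *_) (Σℤ-ι (λ x → p (stat x)) xs)))
                 (Σℤ-evalC cs stat xs) ⟩
  c * + cnt (λ x → p (stat x)) xs + countC cs stat xs ∎
  where open ≡-Reasoning

stat : ℕ → List ℕ → Bool × ℕ
stat n π = ends n π , adj4 n π

-- The six classes of permutations π of {0,…,n-1} contributing to
-- f(n+1, j), each with the number of insertions of n that land on j
-- adjacencies.
classTerms : ℕ → ℕ → Combination (Bool × ℕ)
classTerms n j =
    (+ 2                 , (λ (l , k) → not l ∧ (suc k ≡ᵇ j)))
  ∷ (+ j + + 1           , (λ (l , k) → not l ∧ (k ≡ᵇ suc j)))
  ∷ (+ suc n - + j - + 2 , (λ (l , k) → not l ∧ (k ≡ᵇ j)))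
  ∷ (+ 1                 , (λ (l , k) → l ∧ (suc k ≡ᵇ j)))
  ∷ (+ j + + 1           , (λ (l , k) → l ∧ (k ≡ᵇ suc (suc j))))
  ∷ (+ suc n - + j - + 1 , (λ (l , k) → l ∧ (k ≡ᵇ suc j)))
  ∷ []

indicator-scale : ∀ A j {c d : ℤ} → (A ≡ j → c ≡ d) → c * + ι (A ≡ᵇ j) ≡ d * + ι (A ≡ᵇ j)
indicator-scale A j {c} {d} c≡d with A ≡ᵇ j | ≡ᵇ-reflects A j
... | .true  | ofʸ A≡j = cong (_* + 1) (c≡d A≡j)
... | .false | ofⁿ _   = trans (ℤ.*-zeroʳ c) (sym (ℤ.*-zeroʳ d))

-- The A breaking gaps of a permutation with A adjacencies land on A-1;
-- they count only for A = j+1.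
breaking-term : ∀ A j → + (A ℕ.* ι (pred A ≡ᵇ j)) ≡ (+ j + + 1) * + ι (A ≡ᵇ suc j)
breaking-term zero    j = sym (ℤ.*-zeroʳ (+ j + + 1))
breaking-term (suc A) j =
  trans (ℤ.pos-* (suc A) (ι (A ≡ᵇ j)))
        (indicator-scale (suc A) (suc j) (λ A≡j → cong +_ (trans A≡j (ℕ.+-comm 1 j))))

neutral-coefficient : ∀ A N d → + N ≡ + (d ℕ.+ (A ℕ.+ N)) - + A - + d
neutral-coefficient A N d rewrite ℤ.pos-+ d (A ℕ.+ N) | ℤ.pos-+ A N = lemma (+ A) (+ N) (+ d)
  where
  lemma : ∀ a n d → n ≡ d + (a + n) - a - d
  lemma = solve-∀

pos-+₃ : ∀ a b c → + (a ℕ.+ b ℕ.+ c) ≡ + a + + b + + c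
pos-+₃ a b c = trans (ℤ.pos-+ (a ℕ.+ b) c) (cong (_+ + c) (ℤ.pos-+ a b))

insertions-by-class : ∀ u π → π ∈ perms (suc u) → ∀ j →
  + exact-insertions (suc u) π j ≡ evalC (classTerms (suc u) j) (stat (suc u) π)
insertions-by-class u π π∈ j with insertion-counts u π π∈
... | not-ending A N e adj size count = begin
  + exact-insertions n π j
    ≡⟨ cong +_ (count j) ⟩
  + (A ℕ.* ι (pred A ≡ᵇ j) ℕ.+ N ℕ.* ι (A ≡ᵇ j) ℕ.+ 2 ℕ.* ι (suc A ≡ᵇ j))
    ≡⟨ pos-+₃ (A ℕ.* ι (pred A ≡ᵇ j)) (N ℕ.* ι (A ≡ᵇ j)) (2 ℕ.* ι (suc A ≡ᵇ j)) ⟩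
  + (A ℕ.* ι (pred A ≡ᵇ j)) + + (N ℕ.* ι (A ≡ᵇ j)) + + (2 ℕ.* ι (suc A ≡ᵇ j))
    ≡⟨ cong₂ _+_ (cong₂ _+_ (breaking-term A j) neutral-gaps) (ℤ.pos-* 2 (ι (suc A ≡ᵇ j))) ⟩
  (+ j + + 1) * y + (+ suc n - + j - + 2) * z + + 2 * x
    ≡⟨ lemma (+ j + + 1) (+ suc n - + j - + 2) (+ suc n - + j - + 1) x y z ⟩
  evalC (classTerms n j) (false , A)
    ≡⟨ cong (evalC (classTerms n j)) (cong₂ _,_ e adj) ⟨
  evalC (classTerms n j) (stat n π) ∎
  where
  open ≡-Reasoning
  n = suc u
  x = + ι (suc A ≡ᵇ j)
  y = + ι (A ≡ᵇ suc j)
  z = + ι (A ≡ᵇ j)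
  neutral-gaps : + (N ℕ.* ι (A ≡ᵇ j)) ≡ (+ suc n - + j - + 2) * z
  neutral-gaps = trans (ℤ.pos-* N (ι (A ≡ᵇ j))) (indicator-scale A j {+ N} {+ suc n - + j - + 2} λ { refl →
    trans (neutral-coefficient A N 2) (cong (λ t → + t - + A - + 2) (cong suc (trans (sym (ℕ.+-suc A N)) size))) })
  lemma : ∀ s t t′ x y z → s * y + t * z + + 2 * x ≡
          + 2 * x + (s * y + (t * z + (+ 1 * + 0 + (s * + 0 + (t′ * + 0 + + 0)))))
  lemma = solve-∀
... | ending A N e adj size count = begin
  + exact-insertions n π j
    ≡⟨ cong +_ (count j) ⟩
  + (A ℕ.* ι (pred A ≡ᵇ j) ℕ.+ N ℕ.* ι (A ≡ᵇ j) ℕ.+ ι (suc (suc A) ≡ᵇ j))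
    ≡⟨ pos-+₃ (A ℕ.* ι (pred A ≡ᵇ j)) (N ℕ.* ι (A ≡ᵇ j)) (ι (suc (suc A) ≡ᵇ j)) ⟩
  + (A ℕ.* ι (pred A ≡ᵇ j)) + + (N ℕ.* ι (A ≡ᵇ j)) + x
    ≡⟨ cong (_+ x) (cong₂ _+_ (breaking-term A j) neutral-gaps) ⟩
  (+ j + + 1) * y + (+ suc n - + j - + 1) * z + x
    ≡⟨ lemma (+ j + + 1) (+ suc n - + j - + 2) (+ suc n - + j - + 1) x y z ⟩
  evalC (classTerms n j) (true , suc A)
    ≡⟨ cong (evalC (classTerms n j)) (cong₂ _,_ e adj) ⟨
  evalC (classTerms n j) (stat n π) ∎
  where
  open ≡-Reasoning
  n = suc u
  x = + ι (suc (suc A) ≡ᵇ j)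
  y = + ι (A ≡ᵇ suc j)
  z = + ι (A ≡ᵇ j)
  neutral-gaps : + (N ℕ.* ι (A ≡ᵇ j)) ≡ (+ suc n - + j - + 1) * z
  neutral-gaps = trans (ℤ.pos-* N (ι (A ≡ᵇ j))) (indicator-scale A j {+ N} {+ suc n - + j - + 1} λ { refl →
    trans (neutral-coefficient A N 1) (cong (λ t → + suc t - + A - + 1) size) })
  lemma : ∀ s t t′ x y z → s * y + t′ * z + x ≡
          + 2 * + 0 + (s * + 0 + (t * + 0 + (+ 1 * x + (s * y + (t′ * z + + 0)))))
  lemma = solve-∀

decomposition : ∀ u j →
  + countAdj (suc (suc u)) j ≡ countC (classTerms (suc u) j) (stat (suc u)) (perms (suc u))
decomposition u j = begin
  + countAdj (suc n) j
    ≡⟨ cong +_ (length-filter (λ w → adj4 (suc n) w ℕ.≟ j) (perms (suc n))) ⟩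
  + cnt (λ w → adj4 (suc n) w ≡ᵇ j) (perms (suc n))
    ≡⟨ cong +_ (count-by-insertion n (λ w → adj4 (suc n) w ≡ᵇ j)) ⟩
  + sum (map (λ π → exact-insertions n π j) (perms n))
    ≡⟨ pos-sum (λ π → exact-insertions n π j) (perms n) ⟩
  Σℤ (λ π → + exact-insertions n π j) (perms n)
    ≡⟨ Σℤ-cong _ _ (perms n) (λ π∈ → insertions-by-class u _ π∈ j) ⟩
  Σℤ (λ π → evalC (classTerms n j) (stat n π)) (perms n)
    ≡⟨ Σℤ-evalC (classTerms n j) (stat n) (perms n) ⟩
  countC (classTerms n j) (stat n) (perms n) ∎
  where
  open ≡-Reasoning
  n = suc u

#adj : ℕ → (ℕ → Bool) → ℕ
#adj n q = cnt (λ π → q (adj4 n π)) (perms n)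

not-ending-class : ∀ u (q : ℕ → Bool) →
  + cnt (λ π → not (ends (suc (suc u)) π) ∧ q (adj4 (suc (suc u)) π)) (perms (suc (suc u))) ≡
  + #adj (suc (suc u)) q - + #adj (suc u) (λ k → q (suc k))
not-ending-class u q = begin
  + H
    ≡⟨ cancel H G ⟩
  + (H ℕ.+ G) - + G
    ≡⟨ cong₂ (λ a b → + a - + b) (sym (cnt-split (λ π → q (adj4 n π)) (ends n) (perms n))) (ending-count u q) ⟩
  + #adj n q - + #adj (suc u) (λ k → q (suc k)) ∎
  where
  open ≡-Reasoning
  n = suc (suc u)
  H = cnt (λ π → not (ends n π) ∧ q (adj4 n π)) (perms n)
  G = cnt (λ π → ends n π ∧ q (adj4 n π)) (perms n)
  cancel : ∀ a b → + a ≡ + (a ℕ.+ b) - + b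
  cancel a b rewrite ℤ.pos-+ a b = lemma (+ a) (+ b)
    where
    lemma : ∀ x y → x ≡ x + y - y
    lemma = solve-∀

-- Shifted adjacency conditions are f at shifted arguments (f vanishes at
-- negative arguments, matching the conditions that no k satisfies).
f-exact : ∀ n j → + #adj n (λ k → k ≡ᵇ j) ≡ f n (+ j)
f-exact n j = cong +_ (sym (length-filter (λ π → adj4 n π ℕ.≟ j) (perms n)))

f-plus1 : ∀ n j → + #adj n (λ k → k ≡ᵇ suc j) ≡ f n (+ j + + 1)
f-plus1 n j = trans (f-exact n (suc j)) (cong (λ t → f n (+ t)) (ℕ.+-comm 1 j))

f-minus1 : ∀ n j → + #adj n (λ k → suc k ≡ᵇ j) ≡ f n (+ j - + 1)
f-minus1 n zero    = cong +_ (cnt-false (perms n))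
f-minus1 n (suc j) = f-exact n j

f-minus2 : ∀ n j → + #adj n (λ k → suc (suc k) ≡ᵇ j) ≡ f n (+ j - + 2)
f-minus2 n zero          = cong +_ (cnt-false (perms n))
f-minus2 n (suc zero)    = cong +_ (cnt-false (perms n))
f-minus2 n (suc (suc j)) = f-exact n j

regroup : ∀ (t₂ t₁ s h₁ h₂ h₃ g₁ g₄ g₂ a₋ a a₊ b₋₂ b₋ b b₊ : ℤ) →
  h₁ ≡ a₋ - b₋₂ → h₂ ≡ a₊ - b → h₃ ≡ a - b₋ → g₁ ≡ b₋₂ → g₄ ≡ b₊ → g₂ ≡ b →
  + 2 * h₁ + (s * h₂ + (t₂ * h₃ + (+ 1 * g₁ + (s * g₄ + (t₁ * g₂ + + 0))))) ≡
  t₂ * (a - b₋) + + 2 * (a₋ - b₋₂) + b₋₂ + s * (a₊ - b) + t₁ * b + s * b₊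
regroup t₂ t₁ s _ _ _ _ _ _ a₋ a a₊ b₋₂ b₋ b b₊ refl refl refl refl refl refl =
  lemma t₂ t₁ s a₋ a a₊ b₋₂ b₋ b b₊
  where
  lemma : ∀ t₂ t₁ s a₋ a a₊ b₋₂ b₋ b b₊ →
    + 2 * (a₋ - b₋₂) + (s * (a₊ - b) + (t₂ * (a - b₋) + (+ 1 * b₋₂ + (s * b₊ + (t₁ * b + + 0))))) ≡
    t₂ * (a - b₋) + + 2 * (a₋ - b₋₂) + b₋₂ + s * (a₊ - b) + t₁ * b + s * b₊
  lemma = solve-∀

-- The recurrence: decompose f(i, j) by inserting i-1 (i = n+1, so that
-- i ∸ 1 = n and i ∸ 2 = n-1), then express the not-ending classes through
-- f(n, ·) and f(n-1, ·) and the ending classes through f(n-1, ·).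
theorem3 : (i j : ℕ) → 3 ≤ i → j ≤ suc i →
    f i (+ j) ≡ (+ i - + j - + 2) * (f (i ∸ 1) (+ j) - f (i ∸ 2) (+ j - + 1))
    + + 2 * (f (i ∸ 1) (+ j - + 1) - f (i ∸ 2) (+ j - + 2)) + f (i ∸ 2) (+ j - + 2)
    + (+ j + + 1) * (f (i ∸ 1) (+ j + + 1) - f (i ∸ 2) (+ j))
    + (+ i - + j - + 1) * f (i ∸ 2) (+ j) + (+ j + + 1) * f (i ∸ 2) (+ j + + 1)
theorem3 0                   j ()                  _
theorem3 1                   j (s≤s ())            _
theorem3 2                   j (s≤s (s≤s ()))      _
theorem3 (suc (suc (suc m))) j _ _ =
  trans (decomposition (suc m) j)
    (regroup (+ suc n - + j - + 2) (+ suc n - + j - + 1) (+ j + + 1) _ _ _ _ _ _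
             (f n (+ j - + 1)) (f n (+ j)) (f n (+ j + + 1))
             (f (suc m) (+ j - + 2)) (f (suc m) (+ j - + 1)) (f (suc m) (+ j)) (f (suc m) (+ j + + 1))
      (trans (not-ending-class m (λ k → suc k ≡ᵇ j)) (cong₂ _-_ (f-minus1 n j) (f-minus2 (suc m) j)))
      (trans (not-ending-class m (λ k → k ≡ᵇ suc j)) (cong₂ _-_ (f-plus1 n j) (f-exact (suc m) j)))
      (trans (not-ending-class m (λ k → k ≡ᵇ j)) (cong₂ _-_ (f-exact n j) (f-minus1 (suc m) j)))
      (trans (cong +_ (ending-count m (λ k → suc k ≡ᵇ j))) (f-minus2 (suc m) j))
      (trans (cong +_ (ending-count m (λ k → k ≡ᵇ suc (suc j)))) (f-plus1 (suc m) j))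
      (trans (cong +_ (ending-count m (λ k → k ≡ᵇ suc j))) (f-exact (suc m) j)))
  where n = suc (suc m)
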